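{- Let $q=p^r$ with $p$ prime and $r\ge1$, let $n$ be a positive integer, and let $\mathrm{Tr}(x)=\sum_{i=0}^{n-1}x^{q^i}$ be the trace map from $\mathbb{F}_{q^n}$ to $\mathbb{F}_q$. Let $h(x)\in\mathbb{F}_q[x]$, let $k$ be a positive integer with $\gcd(k,n)=1$, and assume $p\nmid n$ and $\gcd(n,p^{\gcd(k,r)}-1)=1$. Then for every $a\in\mathbb{F}_q^*$, the polynomial \[x\left(h(\mathrm{Tr}(x))+a\,\mathrm{Tr}(x)^{p^k-1}-a\,x^{p^k-1}\right)\] is a complete permutation polynomial of $\mathbb{F}_{q^n}$ if and only if $x h(x)$ is a complete permutation polynomial of $\mathbb{F}_q$.
   Context: A polynomial $f(x)\in\mathbb{F}_Q[x]$ is a permutation polynomial of $\mathbb{F}_Q$ if the map $\alpha\mapsto f(\alpha)$ is a bijection of $\mathbb{F}_Q$. It is a complete permutation polynomial of $\mathbb{F}_Q$ if both $f(x)$ and $f(x)+x$ are permutation polynomials of $\mathbb{F}_Q$. -}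

module Defs where

open import Level using (0ℓ)
open import Data.Nat as ℕ using (ℕ; zero; suc)
open import Data.List using (List; []; _∷_; length)
open import Data.List.Relation.Unary.Any using (Any)
open import Data.List.Relation.Unary.AllPairs using (AllPairs)
open import Data.Product using (Σ; ∃; _×_; _,_)
open import Relation.Nullary using (¬_)
open import Data.Unit using (⊤)
open import Algebra.Bundles using (CommutativeRing)

-- A finite field: a commutative ring in which 0 ≉ 1 and every nonzero
-- element has a multiplicative inverse, together with an enumeration
-- of all its elements without repetitions (up to ≈), so that its
-- cardinality is the length of that list.
record FiniteField : Set₁ where
  field
    commRing : CommutativeRing 0ℓ 0ℓ
  open CommutativeRing commRing public
  field
    0≉1      : ¬ (0# ≈ 1#)
    inverse  : ∀ x → ¬ (x ≈ 0#) → Σ Carrier λ y → (x * y) ≈ 1#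
    elements : List Carrier
    complete : ∀ x → Any (x ≈_) elements
    distinct : AllPairs (λ x y → ¬ (x ≈ y)) elements

module FieldOps (F : FiniteField) where
  open FiniteField F

  pow : Carrier → ℕ → Carrier
  pow x zero    = 1#
  pow x (suc m) = x * pow x m

  sumTo : ℕ → (ℕ → Carrier) → Carrier
  sumTo zero    f = 0#
  sumTo (suc m) f = sumTo m f + f m

  trace : (q n : ℕ) → Carrier → Carrier
  trace q n x = sumTo n (λ i → pow x (q ℕ.^ i))

  -- polynomial given by coefficient list c₀ ∷ c₁ ∷ … (ascending degree),
  -- evaluated by Horner's rule
  eval : List Carrier → Carrier → Carrier
  eval []       x = 0#
  eval (c ∷ cs) x = c + x * eval cs x

  InSub : ℕ → Carrier → Set
  InSub q x = pow x q ≈ x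

  IsPermOn : (Carrier → Set) → (Carrier → Carrier) → Set
  IsPermOn S f =
    (∀ x → S x → S (f x)) ×
    (∀ x y → S x → S y → f x ≈ f y → x ≈ y) ×
    (∀ y → S y → Σ Carrier λ x → S x × f x ≈ y)

  IsCompletePermOn : (Carrier → Set) → (Carrier → Carrier) → Set
  IsCompletePermOn S f = IsPermOn S f × IsPermOn S (λ x → f x + x)

  Everything : Carrier → Set
  Everything _ = ⊤

{-# OPTIONS --safe #-}
-- The polynomial f(x) = x (h(Tr x) + a Tr(x)^(p^k-1) - a x^(p^k-1)) equals c x - a x^(p^k) with
-- c ∈ F_q depending only on Tr x, so Tr ∘ f = g ∘ Tr for g(y) = y h(y), and Tr maps F_(q^n) onto F_q.
-- Hence if f permutes F_(q^n) then g is onto F_q, so it permutes F_q. Conversely, if g permutes F_q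
-- and f x = f y, then Tr x = Tr y, and z = x - y has trace 0 and satisfies z^(p^k) = γ z with γ ∈ F_q;
-- the gcd conditions force such a z into F_q, where Tr z = n z with p ∤ n, so z = 0.
-- Replacing h by h + 1 turns f and g into f + id and g + id, which gives the statement for complete
-- permutations.
module Submission where

open import Defs
open import Data.Nat as N using (ℕ; zero; suc; _≥_)
import Data.Nat.Properties as NP
open import Data.Nat.Primality using (Prime; euclidsLemma; prime⇒irreducible; prime⇒nonZero; prime⇒nonTrivial)
open import Data.Nat.Divisibility using (_∣_; divides; ∣⇒≤; ∣-trans; m∣m*n)
open import Data.Nat.GCD using (gcd; gcd[m,n]∣m; gcd[m,n]∣n; gcd-greatest; gcd-GCD; module GCD; module Bézout)
open import Data.Nat.Coprimality using (Coprime; coprime-divisor; coprime-Bézout; gcd≡1⇒coprime)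
open import Data.Nat.Combinatorics using (_C_; nCk+nC[k+1]≡[n+1]C[k+1]; nC1≡n; nCn≡1)
open import Data.Nat.Combinatorics.Specification using (k>n⇒nCk≡0)
open import Data.List using (List; []; _∷_; length)
open import Data.List.Relation.Unary.All as All using (All; []; _∷_; tabulateₛ; all?)
open import Data.List.Relation.Unary.All.Properties using (¬All⇒Any¬)
open import Data.List.Relation.Unary.Any as Any using (here; there; _─_; satisfied)
open import Data.List.Relation.Unary.AllPairs using ([]; _∷_)
open import Data.Product using (Σ; _×_; _,_; proj₁; proj₂)
open import Data.Sum using (inj₁; inj₂)
open import Data.Empty using (⊥; ⊥-elim)
open import Relation.Nullary using (¬_; Dec; yes; no)
open import Data.Unit using (tt)
open import Relation.Binary.PropositionalEquality as P using (_≡_)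
open import Relation.Binary.Bundles using (DecSetoid)
open import Level using (0ℓ)
open import Function.Bundles using (_⇔_; mk⇔)

-- Binomial coefficients, gcds and Bézout identities

[1+k]*[1+n]C[1+k]≡[1+n]*nCk : ∀ n k → suc k N.* (suc n C suc k) ≡ suc n N.* (n C k)
[1+k]*[1+n]C[1+k]≡[1+n]*nCk zero zero = P.refl
[1+k]*[1+n]C[1+k]≡[1+n]*nCk zero (suc k)
  rewrite k>n⇒nCk≡0 {1} {suc (suc k)} (N.s≤s (N.s≤s N.z≤n))
        | k>n⇒nCk≡0 {0} {suc k} (N.s≤s N.z≤n) = NP.*-zeroʳ (suc (suc k))
[1+k]*[1+n]C[1+k]≡[1+n]*nCk (suc n) zero
  rewrite nC1≡n (suc (suc n)) = P.trans (NP.+-identityʳ _) (P.sym (NP.*-identityʳ _))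
[1+k]*[1+n]C[1+k]≡[1+n]*nCk (suc n) (suc k) = begin
  suc K N.* (suc m C suc K)             ≡⟨ P.cong (suc K N.*_) (nCk+nC[k+1]≡[n+1]C[k+1] m K) ⟨
  suc K N.* (m C K N.+ m C suc K)       ≡⟨ NP.*-distribˡ-+ (suc K) (m C K) (m C suc K) ⟩
  suc K N.* (m C K) N.+ suc K N.* (m C suc K)
    ≡⟨ P.cong (suc K N.* (m C K) N.+_) ([1+k]*[1+n]C[1+k]≡[1+n]*nCk n K) ⟩
  (m C K N.+ K N.* (m C K)) N.+ m N.* (n C K)
    ≡⟨ P.cong (λ t → (m C K N.+ t) N.+ m N.* (n C K)) ([1+k]*[1+n]C[1+k]≡[1+n]*nCk n k) ⟩
  (m C K N.+ m N.* (n C k)) N.+ m N.* (n C K) ≡⟨ NP.+-assoc (m C K) (m N.* (n C k)) (m N.* (n C K)) ⟩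
  m C K N.+ (m N.* (n C k) N.+ m N.* (n C K)) ≡⟨ P.cong (m C K N.+_) (NP.*-distribˡ-+ m (n C k) (n C K)) ⟨
  m C K N.+ m N.* (n C k N.+ n C K)
    ≡⟨ P.cong (λ t → m C K N.+ m N.* t) (nCk+nC[k+1]≡[n+1]C[k+1] n k) ⟩
  suc m N.* (m C K)                           ∎
  where
  open P.≡-Reasoning
  m = suc n
  K = suc k

p∣pCk : ∀ {p k} → Prime p → 0 N.< k → k N.< p → p ∣ p C k
p∣pCk {suc n} {suc k} p-prime _ k<p
  with euclidsLemma (suc k) (suc n C suc k) p-prime
         (divides (n C k) (P.trans ([1+k]*[1+n]C[1+k]≡[1+n]*nCk n k) (NP.*-comm (suc n) (n C k))))
... | inj₁ p∣1+k = ⊥-elim (NP.<⇒≱ k<p (∣⇒≤ p∣1+k))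
... | inj₂ p∣pCk = p∣pCk

coprime⇒gcd[k,m*n]≡gcd[k,m] : ∀ {k n} m → Coprime k n → gcd k (m N.* n) ≡ gcd k m
coprime⇒gcd[k,m*n]≡gcd[k,m] {k} {n} m k⊥n = GCD.unique (gcd-GCD k (m N.* n)) isGCD
  where
  greatest : ∀ {c} → c ∣ k × c ∣ m N.* n → c ∣ gcd k m
  greatest {c} (c∣k , c∣mn) = gcd-greatest c∣k (coprime-divisor c⊥n (P.subst (c ∣_) (NP.*-comm m n) c∣mn))
    where
    c⊥n : Coprime c n
    c⊥n (i∣c , i∣n) = k⊥n (∣-trans i∣c c∣k , i∣n)
  isGCD : GCD.GCD k (m N.* n) (gcd k m)
  isGCD = GCD.is (gcd[m,n]∣m k m , ∣-trans (gcd[m,n]∣n k m) (m∣m*n n)) greatest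

prime∤⇒coprime : ∀ {p n} → Prime p → ¬ p ∣ n → Coprime p n
prime∤⇒coprime p-prime p∤n (d∣p , d∣n) with prime⇒irreducible p-prime d∣p
... | inj₁ d≡1    = d≡1
... | inj₂ P.refl = ⊥-elim (p∤n d∣n)

module BézoutClosed (P : ℕ → Set) (P0 : P 0)
  (P-+ : ∀ {m n} → P m → P n → P (m N.+ n))
  (P-∸ : ∀ {d m} → P (d N.+ m) → P m → P d) where

  P-* : ∀ x {m} → P m → P (x N.* m)
  P-* zero    _  = P0
  P-* (suc x) Pm = P-+ Pm (P-* x Pm)

  bézout : ∀ {d a b} → Bézout.Identity d a b → P a → P b → P d
  bézout (Bézout.+- x y eq) Pa Pb = P-∸ (P.subst P (P.sym eq) (P-* x Pa)) (P-* y Pb)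
  bézout (Bézout.-+ x y eq) Pa Pb = P-∸ (P.subst P (P.sym eq) (P-* y Pb)) (P-* x Pa)

-- Duplicate-free lists

module UniqueLists {c ℓ} (S : DecSetoid c ℓ) where
  open DecSetoid S renaming (Carrier to A)
  open import Data.List.Membership.Setoid setoid using (_∈_; _∉_)
  open import Data.List.Membership.DecSetoid S using (_∈?_)
  open import Data.List.Membership.Setoid.Properties using (∈-resp-≈; ∉⇒All[≉]; All[≉]⇒∉)
  open import Data.List.Relation.Unary.Unique.Setoid setoid using (Unique)
  open import Data.List.Relation.Binary.Subset.Setoid setoid using (_⊆_)
  open import Data.List.Relation.Binary.Permutation.Setoid setoid
    using (_↭_; ↭-refl; ↭-sym; ↭-prep; ↭-swap; ↭-trans)
  open import Data.List.Relation.Binary.Permutation.Homogeneous using (prep)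
  open import Data.List.Properties using (length-removeAt′)

  ─-⊆ : ∀ {z ys} (z∈ys : z ∈ ys) → (ys ─ z∈ys) ⊆ ys
  ─-⊆ (here _)      w∈ys           = there w∈ys
  ─-⊆ (there z∈ys)  (here w≈y)     = here w≈y
  ─-⊆ (there z∈ys)  (there w∈ys─z) = there (─-⊆ z∈ys w∈ys─z)

  ∈-─ : ∀ {z w ys} (z∈ys : z ∈ ys) → w ∈ ys → ¬ w ≈ z → w ∈ (ys ─ z∈ys)
  ∈-─ (here z≈y)   (here w≈y)  w≉z = ⊥-elim (w≉z (trans w≈y (sym z≈y)))
  ∈-─ (here _)     (there w∈ys) _  = w∈ys
  ∈-─ (there _)    (here w≈y)  _   = here w≈y
  ∈-─ (there z∈ys) (there w∈ys) w≉z = there (∈-─ z∈ys w∈ys w≉z)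

  All-─ : ∀ {P : A → Set ℓ} {z ys} (z∈ys : z ∈ ys) → All P ys → All P (ys ─ z∈ys)
  All-─ (here _)     (_ ∷ Pys)   = Pys
  All-─ (there z∈ys) (Py ∷ Pys) = Py ∷ All-─ z∈ys Pys

  Unique-─ : ∀ {z ys} (z∈ys : z ∈ ys) → Unique ys → Unique (ys ─ z∈ys)
  Unique-─ (here _)     (_ ∷ u)     = u
  Unique-─ (there z∈ys) (y≉ys ∷ u) = All-─ z∈ys y≉ys ∷ Unique-─ z∈ys u

  Unique⇒∉-─ : ∀ {z ys} (z∈ys : z ∈ ys) → Unique ys → z ∉ (ys ─ z∈ys)
  Unique⇒∉-─ (here z≈y)   (y≉ys ∷ _) z∈ys─z = All[≉]⇒∉ setoid y≉ys (∈-resp-≈ setoid z≈y z∈ys─z)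
  Unique⇒∉-─ (there z∈ys) (y≉ys ∷ u) (here z≈y) =
    All[≉]⇒∉ setoid y≉ys (∈-resp-≈ setoid z≈y z∈ys)
  Unique⇒∉-─ (there z∈ys) (_ ∷ u)    (there z∈ys─z) = Unique⇒∉-─ z∈ys u z∈ys─z

  ↭-─ : ∀ {z ys} (z∈ys : z ∈ ys) → ys ↭ z ∷ (ys ─ z∈ys)
  ↭-─ (here z≈y)           = prep (sym z≈y) ↭-refl
  ↭-─ {z} {y ∷ _} (there z∈ys) = ↭-trans (↭-prep y (↭-─ z∈ys)) (↭-swap y z ↭-refl)

  Unique-∷-⊆⇒⊆-─ : ∀ {x xs ys} → Unique (x ∷ xs) → (x∷xs⊆ys : x ∷ xs ⊆ ys) →
                   xs ⊆ (ys ─ x∷xs⊆ys (here refl))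
  Unique-∷-⊆⇒⊆-─ (x≉xs ∷ _) x∷xs⊆ys w∈xs =
    ∈-─ _ (x∷xs⊆ys (there w∈xs)) λ w≈x → All[≉]⇒∉ setoid x≉xs (∈-resp-≈ setoid w≈x w∈xs)

  Unique-⊆⇒length≤ : ∀ {xs ys} → Unique xs → xs ⊆ ys → length xs N.≤ length ys
  Unique-⊆⇒length≤ {[]}     _            _    = N.z≤n
  Unique-⊆⇒length≤ {x ∷ xs} {ys} u@(_ ∷ uxs) x∷xs⊆ys =
    P.subst (suc (length xs) N.≤_) (P.sym (length-removeAt′ ys _))
      (N.s≤s (Unique-⊆⇒length≤ uxs (Unique-∷-⊆⇒⊆-─ u x∷xs⊆ys)))

  Unique-⊆-length≥⇒⊇ : ∀ {xs ys} → Unique xs → xs ⊆ ys → length ys N.≤ length xs → ys ⊆ xs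
  Unique-⊆-length≥⇒⊇ {xs} {ys} u xs⊆ys |ys|≤|xs| {w} w∈ys with w ∈? xs
  ... | yes w∈xs = w∈xs
  ... | no  w∉xs = ⊥-elim (NP.<⇒≱ (Unique-⊆⇒length≤ (∉⇒All[≉] setoid w∉xs ∷ u) w∷xs⊆ys) |ys|≤|xs|)
    where
    w∷xs⊆ys : w ∷ xs ⊆ ys
    w∷xs⊆ys (here v≈w)  = ∈-resp-≈ setoid (sym v≈w) w∈ys
    w∷xs⊆ys (there v∈xs) = xs⊆ys v∈xs

  Unique-⊆-⊇⇒↭ : ∀ {xs ys} → Unique xs → Unique ys → xs ⊆ ys → ys ⊆ xs → xs ↭ ys
  Unique-⊆-⊇⇒↭ {[]}     {[]}     _ _ _ _ = ↭-refl
  Unique-⊆-⊇⇒↭ {[]}     {y ∷ _}  _ _ _ ys⊆[] with ys⊆[] (here refl)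
  ... | ()
  Unique-⊆-⊇⇒↭ {x ∷ xs} {ys} uxxs@(_ ∷ uxs) uys x∷xs⊆ys ys⊆x∷xs =
    ↭-trans (↭-prep x (Unique-⊆-⊇⇒↭ uxs (Unique-─ x∈ys uys) (Unique-∷-⊆⇒⊆-─ uxxs x∷xs⊆ys) ys─x⊆xs))
            (↭-sym (↭-─ x∈ys))
    where
    x∈ys = x∷xs⊆ys (here refl)
    ys─x⊆xs : (ys ─ x∈ys) ⊆ xs
    ys─x⊆xs w∈ys─x with ys⊆x∷xs (─-⊆ x∈ys w∈ys─x)
    ... | here w≈x   = ⊥-elim (Unique⇒∉-─ x∈ys uys (∈-resp-≈ setoid w≈x w∈ys─x))
    ... | there w∈xs = w∈xs

module FiniteFieldTheory (F : FiniteField) where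
  open FiniteField F
  open FieldOps F
  open import Relation.Binary.Reasoning.Setoid setoid
  open import Relation.Binary.Definitions using (Decidable)
  open import Data.Sum using (_⊎_)
  open import Data.List.Membership.Setoid setoid using (_∈_)
  open import Data.List.Membership.Setoid.Properties
    using (∈-resp-≈; All[≉]⇒∉; ∈-filter⁺; ∈-filter⁻; ∈-map⁺; ∈-map⁻)
  open import Data.List.Relation.Unary.Unique.Setoid setoid using (Unique)
  open import Data.List.Relation.Unary.Unique.Setoid.Properties using (filter⁺; map⁺)
  open import Data.List.Relation.Binary.Subset.Setoid setoid using (_⊆_)
  open import Data.List using (filter; map; foldr)
  open import Data.List.Relation.Binary.Permutation.Setoid setoid using (_↭_)
  open import Data.List.Relation.Binary.Permutation.Setoid.Properties setoid using (foldr-commMonoid)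
  open import Algebra.Properties.CommutativeSemigroup +-commutativeSemigroup
    renaming (interchange to +-interchange; xy∙z≈xz∙y to +-xy∙z≈xz∙y) using ()
  open import Algebra.Properties.CommutativeSemigroup *-commutativeSemigroup
    renaming (interchange to *-interchange; x∙yz≈y∙xz to *-x∙yz≈y∙xz) using ()
  open import Data.List.Properties using (length-map; length-removeAt′)
  open import Algebra.Properties.Group +-group
    using (∙-cancelˡ; ∙-cancelʳ; x∙y⁻¹≈ε⇒x≈y; x≈y⇒x∙y⁻¹≈ε; inverseʳ-unique)
  open import Algebra.Properties.Ring ring using (x[y-z]≈xy-xz; x+x≈x⇒x≈0)
  open import Algebra.Properties.AbelianGroup +-abelianGroup using (⁻¹-∙-comm; xyx⁻¹≈y)
  open import Algebra.Properties.CommutativeSemiring.Exp commutativeSemiring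
    using (_^_; ^-homo-*; ^-assocʳ; ^-distrib-*)
  open import Algebra.Properties.Semiring.Mult semiring renaming (_×_ to _·_)
    using (×-congʳ; ×-homo-+; ×1-homo-*; ×-assoc-*)
  open import Algebra.Properties.CommutativeSemiring.Binomial commutativeSemiring using (theorem; binomialTerm)
  open import Algebra.Properties.Monoid.Sum +-monoid using (sum; sum-init-last; sum-cong-≋; sum-replicate-zero)
  import Data.Vec.Functional as VF
  import Data.Fin as Fin
  import Data.Fin.Properties as FP

  ≈-decidable-in : ∀ {x y zs} → Unique zs → x ∈ zs → y ∈ zs → Dec (x ≈ y)
  ≈-decidable-in _          (here x≈z)   (here y≈z)   = yes (trans x≈z (sym y≈z))
  ≈-decidable-in (z≉zs ∷ _) (here x≈z)   (there y∈zs) =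
    no λ x≈y → All[≉]⇒∉ setoid z≉zs (∈-resp-≈ setoid (trans (sym x≈y) x≈z) y∈zs)
  ≈-decidable-in (z≉zs ∷ _) (there x∈zs) (here y≈z)   =
    no λ x≈y → All[≉]⇒∉ setoid z≉zs (∈-resp-≈ setoid (trans x≈y y≈z) x∈zs)
  ≈-decidable-in (_ ∷ u)    (there x∈zs) (there y∈zs) = ≈-decidable-in u x∈zs y∈zs

  _≟_ : Decidable _≈_
  x ≟ y = ≈-decidable-in distinct (complete x) (complete y)

  decSetoid : DecSetoid 0ℓ 0ℓ
  decSetoid = record { isDecEquivalence = record { isEquivalence = isEquivalence ; _≟_ = _≟_ } }

  open UniqueLists decSetoid

  x-y≈0⇒x≈y : ∀ {x y} → x - y ≈ 0# → x ≈ y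
  x-y≈0⇒x≈y = x∙y⁻¹≈ε⇒x≈y _ _

  x≈y⇒x-y≈0 : ∀ {x y} → x ≈ y → x - y ≈ 0#
  x≈y⇒x-y≈0 = x≈y⇒x∙y⁻¹≈ε

  +-cancelˡ : ∀ {x u v} → x + u ≈ x + v → u ≈ v
  +-cancelˡ = ∙-cancelˡ _ _ _

  x*y≈0⇒x≈0⊎y≈0 : ∀ {x y} → x * y ≈ 0# → x ≈ 0# ⊎ y ≈ 0#
  x*y≈0⇒x≈0⊎y≈0 {x} {y} xy≈0 with x ≟ 0#
  ... | yes x≈0 = inj₁ x≈0
  ... | no  x≉0 with inverse x x≉0
  ...   | x⁻¹ , xx⁻¹≈1 = inj₂ (begin
    y               ≈⟨ *-identityˡ y ⟨
    1# * y          ≈⟨ *-congʳ (trans (sym xx⁻¹≈1) (*-comm x x⁻¹)) ⟩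
    (x⁻¹ * x) * y   ≈⟨ *-assoc x⁻¹ x y ⟩
    x⁻¹ * (x * y)   ≈⟨ *-congˡ xy≈0 ⟩
    x⁻¹ * 0#        ≈⟨ zeroʳ x⁻¹ ⟩
    0#              ∎)

  x≉0∧y≉0⇒x*y≉0 : ∀ {x y} → ¬ x ≈ 0# → ¬ y ≈ 0# → ¬ x * y ≈ 0#
  x≉0∧y≉0⇒x*y≉0 x≉0 y≉0 xy≈0 with x*y≈0⇒x≈0⊎y≈0 xy≈0
  ... | inj₁ x≈0 = x≉0 x≈0
  ... | inj₂ y≈0 = y≉0 y≈0

  *-cancelˡ : ∀ {z x y} → ¬ z ≈ 0# → z * x ≈ z * y → x ≈ y
  *-cancelˡ {z} {x} {y} z≉0 zx≈zy with x*y≈0⇒x≈0⊎y≈0 (trans (x[y-z]≈xy-xz z x y) (x≈y⇒x-y≈0 zx≈zy))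
  ... | inj₁ z≈0   = ⊥-elim (z≉0 z≈0)
  ... | inj₂ x-y≈0 = x-y≈0⇒x≈y x-y≈0

  [x-u]-[y-v]≈[x-y]-[u-v] : ∀ x y u v → (x - u) - (y - v) ≈ (x - y) - (u - v)
  [x-u]-[y-v]≈[x-y]-[u-v] x y u v = begin
    (x - u) + - (y - v)      ≈⟨ +-congˡ (⁻¹-∙-comm y (- v)) ⟨
    (x - u) + (- y + - - v)  ≈⟨ +-interchange x (- u) (- y) (- - v) ⟩
    (x - y) + (- u + - - v)  ≈⟨ +-congˡ (⁻¹-∙-comm u (- v)) ⟩
    (x - y) + - (u - v)      ∎

  x-u≈y-v⇒x-y≈u-v : ∀ {x y u v} → x - u ≈ y - v → x - y ≈ u - v
  x-u≈y-v⇒x-y≈u-v {x} {y} {u} {v} x-u≈y-v =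
    x-y≈0⇒x≈y (trans (sym ([x-u]-[y-v]≈[x-y]-[u-v] x y u v)) (x≈y⇒x-y≈0 x-u≈y-v))

  *-cancelʳ : ∀ {z x y} → ¬ z ≈ 0# → x * z ≈ y * z → x ≈ y
  *-cancelʳ z≉0 xz≈yz = *-cancelˡ z≉0 (trans (*-comm _ _) (trans xz≈yz (*-comm _ _)))

  pow≡^ : ∀ x m → pow x m ≡ x ^ m
  pow≡^ x zero    = P.refl
  pow≡^ x (suc m) = P.cong (x *_) (pow≡^ x m)

  pow-congˡ : ∀ {x y} m → x ≈ y → pow x m ≈ pow y m
  pow-congˡ zero    _   = refl
  pow-congˡ (suc m) x≈y = *-cong x≈y (pow-congˡ m x≈y)

  pow-homo-+ : ∀ x m n → pow x (m N.+ n) ≈ pow x m * pow x n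
  pow-homo-+ x m n rewrite pow≡^ x (m N.+ n) | pow≡^ x m | pow≡^ x n = ^-homo-* x m n

  pow-pow : ∀ x m n → pow (pow x m) n ≈ pow x (m N.* n)
  pow-pow x m n rewrite pow≡^ (pow x m) n | pow≡^ x m | pow≡^ x (m N.* n) = ^-assocʳ x m n

  pow-distrib-* : ∀ x y m → pow (x * y) m ≈ pow x m * pow y m
  pow-distrib-* x y m rewrite pow≡^ (x * y) m | pow≡^ x m | pow≡^ y m = ^-distrib-* x y m

  pow-comm : ∀ x m n → pow (pow x m) n ≈ pow (pow x n) m
  pow-comm x m n = begin
    pow (pow x m) n ≈⟨ pow-pow x m n ⟩
    pow x (m N.* n) ≡⟨ P.cong (pow x) (NP.*-comm m n) ⟩
    pow x (n N.* m) ≈⟨ pow-pow x n m ⟨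
    pow (pow x n) m ∎

  pow-identityʳ : ∀ x → pow x 1 ≈ x
  pow-identityʳ = *-identityʳ

  pow-1# : ∀ m → pow 1# m ≈ 1#
  pow-1# zero    = refl
  pow-1# (suc m) = trans (*-identityˡ _) (pow-1# m)

  pow≈0⇒≈0 : ∀ {x} m → pow x m ≈ 0# → x ≈ 0#
  pow≈0⇒≈0 zero    1≈0 = ⊥-elim (0≉1 (sym 1≈0))
  pow≈0⇒≈0 (suc m) xxᵐ≈0 with x*y≈0⇒x≈0⊎y≈0 xxᵐ≈0
  ... | inj₁ x≈0  = x≈0
  ... | inj₂ xᵐ≈0 = pow≈0⇒≈0 m xᵐ≈0

  pow-·1# : ∀ m k → pow (m · 1#) k ≈ (m N.^ k) · 1#
  pow-·1# m zero    = sym (+-identityʳ 1#)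
  pow-·1# m (suc k) = trans (*-congˡ (pow-·1# m k)) (sym (×1-homo-* m (m N.^ k)))

  ·-as-* : ∀ m x → m · x ≈ (m · 1#) * x
  ·-as-* m x = sym (trans (×-assoc-* m 1# x) (×-congʳ m (*-identityˡ x)))

  pow≈self⇒pow-pred≈1 : ∀ {x} m .{{_ : N.NonZero m}} → ¬ x ≈ 0# → pow x m ≈ x → pow x (N.pred m) ≈ 1#
  pow≈self⇒pow-pred≈1 (suc m) x≉0 xᵐ⁺¹≈x = *-cancelˡ x≉0 (trans xᵐ⁺¹≈x (sym (*-identityʳ _)))

  module PowersEqualToOne (w : Carrier) = BézoutClosed (λ m → pow w m ≈ 1#) refl
    (λ {m} {m′} wᵐ≈1 wᵐ′≈1 → trans (pow-homo-+ w m m′) (trans (*-cong wᵐ≈1 wᵐ′≈1) (*-identityˡ 1#)))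
    (λ {d} {m} wᵈ⁺ᵐ≈1 wᵐ≈1 → trans (sym (*-identityʳ _))
       (trans (*-congˡ (sym wᵐ≈1)) (trans (sym (pow-homo-+ w d m)) wᵈ⁺ᵐ≈1)))

  -- Permutations of finite subsets

  IsPermOn-cong : ∀ {S : Carrier → Set} {f g : Carrier → Carrier} → (∀ {x y} → x ≈ y → S y → S x) →
                  (∀ x → f x ≈ g x) → IsPermOn S f → IsPermOn S g
  IsPermOn-cong S-resp f≗g (closed , injective , surjective) =
      (λ x Sx → S-resp (sym (f≗g x)) (closed x Sx))
    , (λ x y Sx Sy gx≈gy → injective x y Sx Sy (trans (f≗g x) (trans gx≈gy (sym (f≗g y)))))
    , (λ y Sy → let (x , Sx , fx≈y) = surjective y Sy in x , Sx , trans (sym (f≗g x)) fx≈y)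

  module FiniteSubset {S : Carrier → Set} (S? : ∀ x → Dec (S x))
                      (S-resp : ∀ {x y} → x ≈ y → S y → S x) where

    members : List Carrier
    members = filter S? elements

    S⇒∈-members : ∀ {x} → S x → x ∈ members
    S⇒∈-members {x} Sx = ∈-filter⁺ setoid S? (λ x≈y → S-resp (sym x≈y)) (complete x) Sx

    ∈-members⇒S : ∀ {x} → x ∈ members → S x
    ∈-members⇒S x∈ = proj₂ (∈-filter⁻ setoid S? (λ x≈y → S-resp (sym x≈y)) {xs = elements} x∈)

    surjective⇒IsPermOn : ∀ {f} → (∀ {x y} → x ≈ y → f x ≈ f y) → (∀ x → S x → S (f x)) →
                          (∀ y → S y → Σ Carrier λ x → S x × f x ≈ y) → IsPermOn S f
    surjective⇒IsPermOn {f} f-cong closed surjective = closed , injective , surjective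
      where
      -- if f x ≈ f y with x ≉ y, then f maps the members other than y onto all members: pigeonhole
      injective : ∀ x y → S x → S y → f x ≈ f y → x ≈ y
      injective x y Sx Sy fx≈fy with x ≟ y
      ... | yes x≈y = x≈y
      ... | no  x≉y = ⊥-elim (NP.1+n≰n
                        (P.subst (N._≤ length (members ─ y∈)) (length-removeAt′ members _) members-short))
        where
        y∈ = S⇒∈-members Sy
        preimage-≉y : ∀ {w} → S w → Σ Carrier λ u → u ∈ (members ─ y∈) × w ≈ f u
        preimage-≉y {w} Sw with surjective w Sw
        ... | u , Su , fu≈w with u ≟ y
        ...   | no  u≉y = u , ∈-─ y∈ (S⇒∈-members Su) u≉y , sym fu≈w
        ...   | yes u≈y =
          x , ∈-─ y∈ (S⇒∈-members Sx) x≉y , trans (sym fu≈w) (trans (f-cong u≈y) (sym fx≈fy))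
        members⊆image : members ⊆ map f (members ─ y∈)
        members⊆image w∈ with preimage-≉y (∈-members⇒S w∈)
        ... | u , u∈ , w≈fu = ∈-resp-≈ setoid (sym w≈fu) (∈-map⁺ setoid setoid f-cong u∈)
        members-short : length members N.≤ length (members ─ y∈)
        members-short = P.subst (length members N.≤_) (length-map f (members ─ y∈))
                          (Unique-⊆⇒length≤ (filter⁺ setoid S? distinct) members⊆image)

  injective⇒surjective : ∀ {f} → (∀ {x y} → f x ≈ f y → x ≈ y) → ∀ y → Σ Carrier λ x → f x ≈ y
  injective⇒surjective {f} injective y
    with ∈-map⁻ setoid setoid (Unique-⊆-length≥⇒⊇ (map⁺ setoid setoid injective distinct) (λ _ → complete _)
                                 (NP.≤-reflexive (P.sym (length-map f elements))) (complete y))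
  ... | x , _ , y≈fx = x , sym y≈fx

  injective⇒map-↭ : ∀ {f} → (∀ {x y} → x ≈ y → f x ≈ f y) → (∀ {x y} → f x ≈ f y → x ≈ y) →
                    map f elements ↭ elements
  injective⇒map-↭ {f} f-cong injective =
    Unique-⊆-⊇⇒↭ (map⁺ setoid setoid injective distinct) distinct (λ _ → complete _) elements⊆image
    where
    elements⊆image : elements ⊆ map f elements
    elements⊆image {y} _ with injective⇒surjective injective y
    ... | x , fx≈y = ∈-resp-≈ setoid fx≈y (∈-map⁺ setoid setoid f-cong (complete x))

  -- The characteristic and Fermat's little theorem

  ∑ : List Carrier → Carrier
  ∑ = foldr _+_ 0#

  ∏ : List Carrier → Carrier
  ∏ = foldr _*_ 1#

  ∑-map-1#+ : ∀ xs → ∑ (map (1# +_) xs) ≈ length xs · 1# + ∑ xs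
  ∑-map-1#+ []       = sym (+-identityˡ 0#)
  ∑-map-1#+ (x ∷ xs) = trans (+-congˡ (∑-map-1#+ xs)) (+-interchange 1# x _ _)

  ∏-map-x* : ∀ x xs → ∏ (map (x *_) xs) ≈ pow x (length xs) * ∏ xs
  ∏-map-x* x []       = sym (*-identityˡ 1#)
  ∏-map-x* x (y ∷ ys) = trans (*-congˡ (∏-map-x* x ys)) (*-interchange x y _ _)

  ∏≉0 : ∀ xs → All (λ x → ¬ x ≈ 0#) xs → ¬ ∏ xs ≈ 0#
  ∏≉0 []       []           1≈0 = 0≉1 (sym 1≈0)
  ∏≉0 (x ∷ xs) (x≉0 ∷ xs≉0) = x≉0∧y≉0⇒x*y≉0 x≉0 (∏≉0 xs xs≉0)

  card·1#≈0# : length elements · 1# ≈ 0#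
  card·1#≈0# = ∙-cancelʳ (∑ elements) _ _ (begin
    length elements · 1# + ∑ elements ≈⟨ ∑-map-1#+ elements ⟨
    ∑ (map (1# +_) elements)          ≈⟨ foldr-commMonoid +-isCommutativeMonoid translation-↭ ⟩
    ∑ elements                        ≈⟨ +-identityˡ (∑ elements) ⟨
    0# + ∑ elements                   ∎)
    where
    translation-↭ : map (1# +_) elements ↭ elements
    translation-↭ = injective⇒map-↭ +-congˡ +-cancelˡ

  nonzero : List Carrier
  nonzero = elements ─ complete 0#

  ≉0⇒∈-nonzero : ∀ {w} → ¬ w ≈ 0# → w ∈ nonzero
  ≉0⇒∈-nonzero w≉0 = ∈-─ (complete 0#) (complete _) w≉0

  ∈-nonzero⇒≉0 : ∀ {w} → w ∈ nonzero → ¬ w ≈ 0#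
  ∈-nonzero⇒≉0 w∈ w≈0 = Unique⇒∉-─ (complete 0#) distinct (∈-resp-≈ setoid w≈0 w∈)

  dilation-↭ : ∀ {x} → ¬ x ≈ 0# → map (x *_) nonzero ↭ nonzero
  dilation-↭ {x} x≉0 =
    Unique-⊆-⊇⇒↭ (map⁺ setoid setoid (*-cancelˡ x≉0) Unique-nonzero) Unique-nonzero
                 image⊆nonzero nonzero⊆image
    where
    Unique-nonzero = Unique-─ (complete 0#) distinct
    image⊆nonzero : map (x *_) nonzero ⊆ nonzero
    image⊆nonzero v∈ with ∈-map⁻ setoid setoid v∈
    ... | w , w∈ , v≈xw =
      ≉0⇒∈-nonzero λ v≈0 → x≉0∧y≉0⇒x*y≉0 x≉0 (∈-nonzero⇒≉0 w∈) (trans (sym v≈xw) v≈0)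
    x⁻¹ = proj₁ (inverse x x≉0)
    nonzero⊆image : nonzero ⊆ map (x *_) nonzero
    nonzero⊆image {w} w∈ =
      ∈-resp-≈ setoid x[x⁻¹w]≈w (∈-map⁺ setoid setoid *-congˡ (≉0⇒∈-nonzero x⁻¹w≉0))
      where
      x[x⁻¹w]≈w : x * (x⁻¹ * w) ≈ w
      x[x⁻¹w]≈w = trans (sym (*-assoc x x⁻¹ w)) (trans (*-congʳ (proj₂ (inverse x x≉0))) (*-identityˡ w))
      x⁻¹w≉0 : ¬ x⁻¹ * w ≈ 0#
      x⁻¹w≉0 x⁻¹w≈0 = ∈-nonzero⇒≉0 w∈ (trans (sym x[x⁻¹w]≈w) (trans (*-congˡ x⁻¹w≈0) (zeroʳ x)))

  pow-length-nonzero≈1 : ∀ {x} → ¬ x ≈ 0# → pow x (length nonzero) ≈ 1#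
  pow-length-nonzero≈1 {x} x≉0 = *-cancelʳ (∏≉0 nonzero (tabulateₛ setoid ∈-nonzero⇒≉0)) (begin
    pow x (length nonzero) * ∏ nonzero ≈⟨ ∏-map-x* x nonzero ⟨
    ∏ (map (x *_) nonzero)             ≈⟨ foldr-commMonoid *-isCommutativeMonoid (dilation-↭ x≉0) ⟩
    ∏ nonzero                          ≈⟨ *-identityˡ _ ⟨
    1# * ∏ nonzero                     ∎)

  fermat : ∀ x → pow x (length elements) ≈ x
  fermat x rewrite length-removeAt′ elements (Any.index (complete 0#)) with x ≟ 0#
  ... | yes x≈0 = trans (*-congʳ x≈0) (trans (zeroˡ _) (sym x≈0))
  ... | no  x≉0 = trans (*-congˡ (pow-length-nonzero≈1 x≉0)) (*-identityʳ x)

  -- Polynomials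

  LeadingNonzero : List Carrier → Set
  LeadingNonzero []           = ⊥
  LeadingNonzero (c ∷ [])     = ¬ c ≈ 0#
  LeadingNonzero (_ ∷ d ∷ ds) = LeadingNonzero (d ∷ ds)

  LeadingNonzero-∷ : ∀ c P → LeadingNonzero P → LeadingNonzero (c ∷ P)
  LeadingNonzero-∷ c (d ∷ ds) ≉0 = ≉0

  eval-[c] : ∀ c x → eval (c ∷ []) x ≈ c
  eval-[c] c x = trans (+-congˡ (zeroʳ x)) (+-identityʳ c)

  eval-cong : ∀ P {x y} → x ≈ y → eval P x ≈ eval P y
  eval-cong []      _   = refl
  eval-cong (c ∷ P) x≈y = +-congˡ (*-cong x≈y (eval-cong P x≈y))

  divide : Carrier → List Carrier → List Carrier
  divide r []           = []
  divide r (c ∷ [])     = []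
  divide r (c ∷ d ∷ ds) = eval (d ∷ ds) r ∷ divide r (d ∷ ds)

  eval-divide : ∀ r P x → eval P x + r * eval (divide r P) x ≈ eval P r + x * eval (divide r P) x
  eval-divide r []           x = trans (+-congˡ (zeroʳ r)) (sym (+-congˡ (zeroʳ x)))
  eval-divide r (c ∷ [])     x =
    +-cong (trans (eval-[c] c x) (sym (eval-[c] c r))) (trans (zeroʳ r) (sym (zeroʳ x)))
  eval-divide r (c ∷ d ∷ ds) x = begin
    (c + x * D) + r * (e + x * q)       ≈⟨ +-congˡ (distribˡ r e (x * q)) ⟩
    (c + x * D) + (r * e + r * (x * q)) ≈⟨ +-interchange c (x * D) (r * e) _ ⟩
    (c + r * e) + (x * D + r * (x * q)) ≈⟨ +-congˡ (+-congˡ (*-x∙yz≈y∙xz r x q)) ⟩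
    (c + r * e) + (x * D + x * (r * q)) ≈⟨ +-congˡ (distribˡ x D (r * q)) ⟨
    (c + r * e) + x * (D + r * q)       ≈⟨ +-congˡ (*-congˡ (eval-divide r (d ∷ ds) x)) ⟩
    (c + r * e) + x * (e + x * q)       ∎
    where
    D = eval (d ∷ ds) x
    e = eval (d ∷ ds) r
    q = eval (divide r (d ∷ ds)) x

  length-divide : ∀ r c cs → length (divide r (c ∷ cs)) ≡ length cs
  length-divide r c []       = P.refl
  length-divide r c (d ∷ ds) = P.cong suc (length-divide r d ds)

  LeadingNonzero-divide : ∀ r c d ds → LeadingNonzero (c ∷ d ∷ ds) →
                          LeadingNonzero (divide r (c ∷ d ∷ ds))
  LeadingNonzero-divide r c d []       d≉0 = λ d≈0 → d≉0 (trans (sym (eval-[c] d r)) d≈0)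
  LeadingNonzero-divide r c d (e ∷ es) ≉0  = LeadingNonzero-divide r d e es ≉0

  root-bound : ∀ P rs → LeadingNonzero P → Unique rs → All (λ r → eval P r ≈ 0#) rs →
               length rs N.< length P
  root-bound []               _        ()
  root-bound (c ∷ cs)         []       _   _          _ = N.s≤s N.z≤n
  root-bound (c ∷ [])         (r ∷ _)  c≉0 _          (c≈0 ∷ _) =
    ⊥-elim (c≉0 (trans (sym (eval-[c] c r)) c≈0))
  root-bound (c ∷ d ∷ ds)     (r ∷ rs) ≉0  (r≉rs ∷ u) (Pr≈0 ∷ Prs≈0) =
    N.s≤s (P.subst (length rs N.<_) (length-divide r c (d ∷ ds))
      (root-bound (divide r (c ∷ d ∷ ds)) rs (LeadingNonzero-divide r c d ds ≉0) u
        (roots-of-quotient r≉rs Prs≈0)))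
    where
    roots-of-quotient : ∀ {xs} → All (λ x → ¬ r ≈ x) xs → All (λ x → eval (c ∷ d ∷ ds) x ≈ 0#) xs →
                        All (λ x → eval (divide r (c ∷ d ∷ ds)) x ≈ 0#) xs
    roots-of-quotient []            []              = []
    roots-of-quotient {x ∷ _} (r≉x ∷ r≉xs) (Px≈0 ∷ Pxs≈0) with eval (divide r (c ∷ d ∷ ds)) x ≟ 0#
    ... | yes Qx≈0 = Qx≈0 ∷ roots-of-quotient r≉xs Pxs≈0
    ... | no  Qx≉0 = ⊥-elim (r≉x (*-cancelʳ Qx≉0 (∙-cancelˡ 0# _ _ (begin
      0# + r * Q                ≈⟨ +-congʳ Px≈0 ⟨
      eval (c ∷ d ∷ ds) x + r * Q ≈⟨ eval-divide r (c ∷ d ∷ ds) x ⟩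
      eval (c ∷ d ∷ ds) r + x * Q ≈⟨ +-congʳ Pr≈0 ⟩
      0# + x * Q                ∎))))
      where Q = eval (divide r (c ∷ d ∷ ds)) x

  monomial : ℕ → List Carrier
  monomial zero    = 1# ∷ []
  monomial (suc m) = 0# ∷ monomial m

  eval-monomial : ∀ m x → eval (monomial m) x ≈ pow x m
  eval-monomial zero    x = eval-[c] 1# x
  eval-monomial (suc m) x = trans (+-identityˡ _) (*-congˡ (eval-monomial m x))

  length-monomial : ∀ m → length (monomial m) ≡ suc m
  length-monomial zero    = P.refl
  length-monomial (suc m) = P.cong suc (length-monomial m)

  LeadingNonzero-monomial : ∀ m → LeadingNonzero (monomial m)
  LeadingNonzero-monomial zero    = λ 1≈0 → 0≉1 (sym 1≈0)
  LeadingNonzero-monomial (suc m) = LeadingNonzero-∷ 0# (monomial m) (LeadingNonzero-monomial m)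

  infixl 6 _⊕_
  _⊕_ : List Carrier → List Carrier → List Carrier
  []       ⊕ Q        = Q
  (c ∷ P)  ⊕ []       = c ∷ P
  (c ∷ P)  ⊕ (d ∷ Q)  = c + d ∷ P ⊕ Q

  eval-⊕ : ∀ P Q x → eval (P ⊕ Q) x ≈ eval P x + eval Q x
  eval-⊕ []      Q       x = sym (+-identityˡ _)
  eval-⊕ (c ∷ P) []      x = sym (+-identityʳ _)
  eval-⊕ (c ∷ P) (d ∷ Q) x = begin
    (c + d) + x * eval (P ⊕ Q) x               ≈⟨ +-congˡ (*-congˡ (eval-⊕ P Q x)) ⟩
    (c + d) + x * (eval P x + eval Q x)        ≈⟨ +-congˡ (distribˡ x _ _) ⟩
    (c + d) + (x * eval P x + x * eval Q x)    ≈⟨ +-interchange c d _ _ ⟩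
    (c + x * eval P x) + (d + x * eval Q x)    ∎

  ⊕-shorter : ∀ P Q → length P N.< length Q → LeadingNonzero Q →
              LeadingNonzero (P ⊕ Q) × length (P ⊕ Q) ≡ length Q
  ⊕-shorter []      Q            _           ≉0 = ≉0 , P.refl
  ⊕-shorter (c ∷ P) (d ∷ [])     (N.s≤s ())  _
  ⊕-shorter (c ∷ P) (d ∷ e ∷ es) (N.s≤s |P|<) ≉0 with ⊕-shorter P (e ∷ es) |P|< ≉0
  ... | ≉0′ , |P⊕Q|≡ = LeadingNonzero-∷ (c + d) (P ⊕ (e ∷ es)) ≉0′ , P.cong suc |P⊕Q|≡

  eval-+1 : ∀ P x → eval (P ⊕ (1# ∷ [])) x ≈ eval P x + 1#
  eval-+1 P x = trans (eval-⊕ P (1# ∷ []) x) (+-congˡ (eval-[c] 1# x))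

  -- The Frobenius map, the subfield F_q and the trace

  frobenius : ∀ {p} → Prime p → p · 1# ≈ 0# → ∀ x y → pow (x + y) p ≈ pow x p + pow y p
  frobenius {suc (suc m)} p-prime p·1≈0 x y
    rewrite pow≡^ (x + y) (2 N.+ m) | pow≡^ x (2 N.+ m) | pow≡^ y (2 N.+ m) = begin
    (x + y) ^ p                                    ≈⟨ theorem p x y ⟩
    t Fin.zero + sum (VF.tail t)                   ≈⟨ +-congʳ first ⟩
    y ^ p + sum (VF.tail t)                        ≈⟨ +-congˡ (sum-init-last (VF.tail t)) ⟩
    y ^ p + (sum (VF.init (VF.tail t)) + t (Fin.fromℕ p))
      ≈⟨ +-congˡ (+-cong middle (last (Fin.fromℕ p) (FP.toℕ-fromℕ p))) ⟩
    y ^ p + (0# + x ^ p)                           ≈⟨ +-congˡ (+-identityˡ _) ⟩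
    y ^ p + x ^ p                                  ≈⟨ +-comm _ _ ⟩
    x ^ p + y ^ p                                  ∎
    where
    p = 2 N.+ m
    t = binomialTerm x y p
    first : t Fin.zero ≈ y ^ p
    first = trans (+-identityʳ _) (*-identityˡ _)
    last : ∀ i → Fin.toℕ i ≡ p → t i ≈ x ^ p
    last i i≡p rewrite i≡p | nCn≡1 p | NP.n∸n≡0 p = trans (+-identityʳ _) (*-identityʳ _)
    p∣·≈0 : ∀ {c} w → p ∣ c → c · w ≈ 0#
    p∣·≈0 {c} w (divides d c≡d*p) = begin
      c · w                        ≈⟨ ·-as-* c w ⟩
      (c · 1#) * w                 ≡⟨ P.cong (λ c → (c · 1#) * w) c≡d*p ⟩
      ((d N.* p) · 1#) * w         ≈⟨ *-congʳ (×1-homo-* d p) ⟩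
      ((d · 1#) * (p · 1#)) * w    ≈⟨ *-congʳ (*-congˡ p·1≈0) ⟩
      ((d · 1#) * 0#) * w          ≈⟨ *-congʳ (zeroʳ _) ⟩
      0# * w                       ≈⟨ zeroˡ w ⟩
      0#                           ∎
    middle : sum (VF.init (VF.tail t)) ≈ 0#
    middle = trans (sum-cong-≋ {suc m} {_} {VF.replicate (suc m) 0#} term≈0) (sum-replicate-zero (suc m))
      where
      term≈0 : ∀ i → VF.init (VF.tail t) i ≈ 0#
      term≈0 i = p∣·≈0 _ (p∣pCk p-prime (N.s≤s N.z≤n)
                   (N.s≤s (P.subst (N._< suc m) (P.sym (FP.toℕ-inject₁ i)) (FP.toℕ<n i))))

  sumTo-cong : ∀ m {f g : ℕ → Carrier} → (∀ i → f i ≈ g i) → sumTo m f ≈ sumTo m g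
  sumTo-cong zero    _   = refl
  sumTo-cong (suc m) f≗g = +-cong (sumTo-cong m f≗g) (f≗g m)

  sumTo-homo-+ : ∀ m f g → sumTo m (λ i → f i + g i) ≈ sumTo m f + sumTo m g
  sumTo-homo-+ zero    f g = sym (+-identityʳ 0#)
  sumTo-homo-+ (suc m) f g = trans (+-congʳ (sumTo-homo-+ m f g)) (+-interchange _ _ _ _)

  sumTo-*ˡ : ∀ m c f → sumTo m (λ i → c * f i) ≈ c * sumTo m f
  sumTo-*ˡ zero    c f = sym (zeroʳ c)
  sumTo-*ˡ (suc m) c f = trans (+-congʳ (sumTo-*ˡ m c f)) (sym (distribˡ c _ _))

  sumTo-const : ∀ m z → sumTo m (λ _ → z) ≈ m · z
  sumTo-const zero    z = refl
  sumTo-const (suc m) z = trans (+-congʳ (sumTo-const m z)) (+-comm _ z)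

  sumTo-suc : ∀ m f → sumTo m (λ i → f (suc i)) + f 0 ≈ sumTo (suc m) f
  sumTo-suc zero    f = refl
  sumTo-suc (suc m) f = trans (+-xy∙z≈xz∙y _ _ _) (+-congʳ (sumTo-suc m f))

  module AdditiveMap (f : Carrier → Carrier) (f-cong : ∀ {x y} → x ≈ y → f x ≈ f y)
                     (homo-+ : ∀ x y → f (x + y) ≈ f x + f y) where

    homo-0# : f 0# ≈ 0#
    homo-0# = x+x≈x⇒x≈0 (f 0#) (trans (sym (homo-+ 0# 0#)) (f-cong (+-identityʳ 0#)))

    homo-neg : ∀ x → f (- x) ≈ - f x
    homo-neg x = inverseʳ-unique (f x) (f (- x))
                   (trans (sym (homo-+ x (- x))) (trans (f-cong (-‿inverseʳ x)) homo-0#))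

    homo-sub : ∀ x y → f (x - y) ≈ f x - f y
    homo-sub x y = trans (homo-+ x (- y)) (+-congˡ (homo-neg y))

    homo-sumTo : ∀ m g → f (sumTo m g) ≈ sumTo m (λ i → f (g i))
    homo-sumTo zero    g = homo-0#
    homo-sumTo (suc m) g = trans (homo-+ _ _) (+-congʳ (homo-sumTo m g))

  module Subfield {p} (p-prime : Prime p) (r n : ℕ) (card : length elements ≡ p N.^ (r N.* n)) where
    instance
      _ = prime⇒nonZero p-prime

    p·1#≈0# : p · 1# ≈ 0#
    p·1#≈0# = pow≈0⇒≈0 (r N.* n) (begin
      pow (p · 1#) (r N.* n) ≈⟨ pow-·1# p (r N.* n) ⟩
      (p N.^ (r N.* n)) · 1# ≡⟨ P.cong (_· 1#) card ⟨
      length elements · 1#   ≈⟨ card·1#≈0# ⟩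
      0#                     ∎)

    φ : ℕ → Carrier → Carrier
    φ j x = pow x (p N.^ j)

    φ-homo-+ : ∀ j x y → φ j (x + y) ≈ φ j x + φ j y
    φ-homo-+ zero    x y = trans (pow-identityʳ _) (sym (+-cong (pow-identityʳ x) (pow-identityʳ y)))
    φ-homo-+ (suc j) x y = begin
      pow (x + y) (p N.* p N.^ j)       ≈⟨ pow-pow (x + y) p (p N.^ j) ⟨
      φ j (pow (x + y) p)               ≈⟨ pow-congˡ (p N.^ j) (frobenius p-prime p·1#≈0# x y) ⟩
      φ j (pow x p + pow y p)           ≈⟨ φ-homo-+ j _ _ ⟩
      φ j (pow x p) + φ j (pow y p)     ≈⟨ +-cong (pow-pow x p (p N.^ j)) (pow-pow y p (p N.^ j)) ⟩
      pow x (p N.* p N.^ j) + pow y (p N.* p N.^ j) ∎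

    module φ (j : ℕ) = AdditiveMap (φ j) (pow-congˡ (p N.^ j)) (φ-homo-+ j)

    q : ℕ
    q = p N.^ r

    Fq : Carrier → Set
    Fq = InSub q

    Fq-resp : ∀ {x y} → x ≈ y → Fq y → Fq x
    Fq-resp x≈y Fq-y = trans (pow-congˡ q x≈y) (trans Fq-y (sym x≈y))

    Fq-+ : ∀ {x y} → Fq x → Fq y → Fq (x + y)
    Fq-+ Fq-x Fq-y = trans (φ-homo-+ r _ _) (+-cong Fq-x Fq-y)

    Fq-* : ∀ {x y} → Fq x → Fq y → Fq (x * y)
    Fq-* Fq-x Fq-y = trans (pow-distrib-* _ _ q) (*-cong Fq-x Fq-y)

    Fq-1# : Fq 1#
    Fq-1# = pow-1# q

    Fq-pow : ∀ {x} → Fq x → ∀ m → Fq (pow x m)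
    Fq-pow Fq-x zero    = Fq-1#
    Fq-pow Fq-x (suc m) = Fq-* Fq-x (Fq-pow Fq-x m)

    Fq-eval : ∀ h {x} → All Fq h → Fq x → Fq (eval h x)
    Fq-eval []      []             _    = φ.homo-0# r
    Fq-eval (c ∷ h) (Fq-c ∷ Fq-h) Fq-x = Fq-+ Fq-c (Fq-* Fq-x (Fq-eval h Fq-h Fq-x))

    Fq-⊕ : ∀ {P Q} → All Fq P → All Fq Q → All Fq (P ⊕ Q)
    Fq-⊕ {[]}    _             Fq-Q          = Fq-Q
    Fq-⊕ {_ ∷ _} Fq-P          []            = Fq-P
    Fq-⊕ {_ ∷ _} (Fq-c ∷ Fq-P) (Fq-d ∷ Fq-Q) = Fq-+ Fq-c Fq-d ∷ Fq-⊕ Fq-P Fq-Q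

    Fq-inverse : ∀ {x y} → Fq x → x * y ≈ 1# → Fq y
    Fq-inverse {x} {y} Fq-x xy≈1 = *-cancelˡ x≉0 (begin
      x * pow y q       ≈⟨ *-congʳ Fq-x ⟨
      pow x q * pow y q ≈⟨ pow-distrib-* x y q ⟨
      pow (x * y) q     ≈⟨ pow-congˡ q xy≈1 ⟩
      pow 1# q          ≈⟨ pow-1# q ⟩
      1#                ≈⟨ xy≈1 ⟨
      x * y             ∎)
      where
      x≉0 : ¬ x ≈ 0#
      x≉0 x≈0 = 0≉1 (trans (sym (zeroˡ y)) (trans (*-congʳ (sym x≈0)) xy≈1))

    Fq-pow-q^ : ∀ {z} → Fq z → ∀ i → pow z (q N.^ i) ≈ z
    Fq-pow-q^ Fq-z zero    = pow-identityʳ _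
    Fq-pow-q^ {z} Fq-z (suc i) = begin
      pow z (q N.* q N.^ i)    ≈⟨ pow-pow z q (q N.^ i) ⟨
      pow (pow z q) (q N.^ i)  ≈⟨ pow-congˡ (q N.^ i) Fq-z ⟩
      pow z (q N.^ i)          ≈⟨ Fq-pow-q^ Fq-z i ⟩
      z                        ∎

    pow-q^n : ∀ x → pow x (q N.^ n) ≈ x
    pow-q^n x = P.subst (λ m → pow x m ≈ x) (P.trans card (P.sym (NP.^-*-assoc p r n))) (fermat x)

    Tr : Carrier → Carrier
    Tr = trace q n

    Tr-cong : ∀ {x y} → x ≈ y → Tr x ≈ Tr y
    Tr-cong x≈y = sumTo-cong n (λ i → pow-congˡ (q N.^ i) x≈y)

    Tr-homo-+ : ∀ x y → Tr (x + y) ≈ Tr x + Tr y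
    Tr-homo-+ x y = trans (sumTo-cong n pow-q^-homo-+) (sumTo-homo-+ n _ _)
      where
      pow-q^-homo-+ : ∀ i → pow (x + y) (q N.^ i) ≈ pow x (q N.^ i) + pow y (q N.^ i)
      pow-q^-homo-+ i rewrite NP.^-*-assoc p r i = φ-homo-+ (r N.* i) x y

    module Tr = AdditiveMap Tr Tr-cong Tr-homo-+

    Tr-*ˡ : ∀ {c} → Fq c → ∀ x → Tr (c * x) ≈ c * Tr x
    Tr-*ˡ {c} Fq-c x = trans (sumTo-cong n cⁱ≈c) (sumTo-*ˡ n c _)
      where
      cⁱ≈c : ∀ i → pow (c * x) (q N.^ i) ≈ c * pow x (q N.^ i)
      cⁱ≈c i = trans (pow-distrib-* c x (q N.^ i)) (*-congʳ (Fq-pow-q^ Fq-c i))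

    Tr-Fq : ∀ {z} → Fq z → Tr z ≈ n · z
    Tr-Fq Fq-z = trans (sumTo-cong n (Fq-pow-q^ Fq-z)) (sumTo-const n _)

    Tr-φ : ∀ j x → Tr (φ j x) ≈ φ j (Tr x)
    Tr-φ j x = sym (trans (φ.homo-sumTo j n _) (sumTo-cong n (λ i → pow-comm x (q N.^ i) (p N.^ j))))

    Fq-Tr : ∀ x → Fq (Tr x)
    Fq-Tr x = ∙-cancelʳ x _ _ (begin
      pow (Tr x) q + x                       ≈⟨ +-cong (φ.homo-sumTo r n f) (sym (pow-identityʳ x)) ⟩
      sumTo n (λ i → φ r (f i)) + pow x 1    ≈⟨ +-congʳ (sumTo-cong n (λ i → trans (pow-pow x (q N.^ i) q)
                                                  (reflexive (P.cong (pow x) (NP.*-comm (q N.^ i) q))))) ⟩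
      sumTo n (λ i → f (suc i)) + f 0        ≈⟨ sumTo-suc n f ⟩
      sumTo (suc n) f                        ≈⟨ +-congˡ (pow-q^n x) ⟩
      Tr x + x                               ∎)
      where
      f : ℕ → Carrier
      f i = pow x (q N.^ i)

    tracePolynomial : ℕ → List Carrier
    tracePolynomial zero    = []
    tracePolynomial (suc m) = tracePolynomial m ⊕ monomial (q N.^ m)

    eval-tracePolynomial : ∀ m x → eval (tracePolynomial m) x ≈ trace q m x
    eval-tracePolynomial zero    x = refl
    eval-tracePolynomial (suc m) x =
      trans (eval-⊕ (tracePolynomial m) _ x) (+-cong (eval-tracePolynomial m x) (eval-monomial (q N.^ m) x))

    tracePolynomial-shape : 1 N.< q → ∀ m → LeadingNonzero (tracePolynomial (suc m)) ×
                            length (tracePolynomial (suc m)) ≡ suc (q N.^ m)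
    tracePolynomial-shape 1<q zero = LeadingNonzero-monomial 1 , P.refl
    tracePolynomial-shape 1<q (suc m) with tracePolynomial-shape 1<q m
    ... | ≉0 , |T|≡ with ⊕-shorter (tracePolynomial (suc m)) (monomial (q N.^ suc m)) shorter
                           (LeadingNonzero-monomial (q N.^ suc m))
      where
      shorter : length (tracePolynomial (suc m)) N.< length (monomial (q N.^ suc m))
      shorter = P.subst₂ N._<_ (P.sym |T|≡) (P.sym (length-monomial (q N.^ suc m)))
                  (N.s≤s (NP.^-monoʳ-< q 1<q (NP.n<1+n m)))
    ...   | ≉0′ , |T′|≡ = ≉0′ , P.trans |T′|≡ (length-monomial (q N.^ suc m))

    Tr-nonzero : 1 N.< q → n ≥ 1 → Σ Carrier λ s → ¬ Tr s ≈ 0#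
    Tr-nonzero 1<q n≥1 with all? (λ x → Tr x ≟ 0#) elements
    ... | no  ¬all = satisfied (¬All⇒Any¬ (λ x → Tr x ≟ 0#) elements ¬all)
    ... | yes all  = ⊥-elim (NP.<⇒≱ (NP.^-monoʳ-< q 1<q (NP.n<1+n (N.pred n))) (N.s≤s⁻¹ too-many-roots))
      where
      n′ = N.pred n
      1+n′≡n : suc n′ ≡ n
      1+n′≡n = NP.suc-pred n ⦃ N.>-nonZero n≥1 ⦄
      T = tracePolynomial (suc n′)
      Tr≗evalT : ∀ x → Tr x ≈ eval T x
      Tr≗evalT x = P.subst (λ m → trace q m x ≈ eval T x) 1+n′≡n (sym (eval-tracePolynomial (suc n′) x))
      too-many-roots : q N.^ suc n′ N.< suc (q N.^ n′)
      too-many-roots = P.subst₂ N._<_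
        (P.trans card (P.trans (P.sym (NP.^-*-assoc p r n)) (P.cong (q N.^_) (P.sym 1+n′≡n))))
        (proj₂ (tracePolynomial-shape 1<q n′))
        (root-bound T elements (proj₁ (tracePolynomial-shape 1<q n′)) distinct
          (All.map (λ {x} Trx≈0 → trans (sym (Tr≗evalT x)) Trx≈0) all))

    Tr-surjective : 1 N.< q → n ≥ 1 → ∀ y → Fq y → Σ Carrier λ x → Tr x ≈ y
    Tr-surjective 1<q n≥1 y Fq-y with Tr-nonzero 1<q n≥1
    ... | s , Trs≉0 with inverse (Tr s) Trs≉0
    ...   | t , Trs*t≈1 = (y * t) * s , (begin
      Tr ((y * t) * s)  ≈⟨ Tr-*ˡ (Fq-* Fq-y (Fq-inverse (Fq-Tr s) Trs*t≈1)) s ⟩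
      (y * t) * Tr s    ≈⟨ *-assoc y t (Tr s) ⟩
      y * (t * Tr s)    ≈⟨ *-congˡ (trans (*-comm t (Tr s)) Trs*t≈1) ⟩
      y * 1#            ≈⟨ *-identityʳ y ⟩
      y                 ∎)

    n·1#≉0# : ¬ p ∣ n → ¬ n · 1# ≈ 0#
    n·1#≉0# p∤n n·1≈0 = 0≉1 (sym (trans (sym (+-identityʳ 1#))
                                (bézout (coprime-Bézout (prime∤⇒coprime p-prime p∤n)) p·1#≈0# n·1≈0)))
      where
      open BézoutClosed (λ m → m · 1# ≈ 0#) refl
        (λ {m} {m′} m·1≈0 m′·1≈0 → trans (×-homo-+ 1# m m′) (trans (+-cong m·1≈0 m′·1≈0) (+-identityʳ 0#)))
        (λ {d} {m} [d+m]·1≈0 m·1≈0 → trans (sym (+-identityʳ _))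
          (trans (+-congˡ (sym m·1≈0)) (trans (sym (×-homo-+ 1# d m)) [d+m]·1≈0)))

    φ-∘ : ∀ j m w → φ j (φ m w) ≈ φ (m N.+ j) w
    φ-∘ j m w = trans (pow-pow w (p N.^ m) (p N.^ j))
                      (reflexive (P.cong (pow w) (P.sym (NP.^-distribˡ-+-* p m j))))

    module FixedBy (w : Carrier) = BézoutClosed (λ j → φ j w ≈ w) (pow-identityʳ w)
      (λ {m} {m′} m-fix m′-fix → trans (sym (φ-∘ m′ m w)) (trans (pow-congˡ (p N.^ m′) m-fix) m′-fix))
      (λ {d} {m} d+m-fix m-fix → begin
         φ d w           ≈⟨ pow-congˡ (p N.^ d) m-fix ⟨
         φ d (φ m w)     ≈⟨ φ-∘ d m w ⟩
         φ (m N.+ d) w   ≡⟨ P.cong (λ j → φ j w) (NP.+-comm m d) ⟩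
         φ (d N.+ m) w   ≈⟨ d+m-fix ⟩
         w               ∎)

    module Eigenvector {k} (k⊥n : Coprime k n) (n⊥p^d∸1 : Coprime n (p N.^ gcd k r N.∸ 1)) where
      instance
        _ = N.>-nonZero (NP.m^n>0 p r)
        _ = N.>-nonZero (NP.m^n>0 p (gcd k r))

      Fixed-k⇒Fixed-gcd : ∀ {w} → φ k w ≈ w → φ (gcd k r) w ≈ w
      Fixed-k⇒Fixed-gcd {w} k-fix = P.subst (λ j → φ j w ≈ w) (coprime⇒gcd[k,m*n]≡gcd[k,m] r k⊥n)
        (FixedBy.bézout w (Bézout.identity (gcd-GCD k (r N.* n))) k-fix rn-fix)
        where
        rn-fix : φ (r N.* n) w ≈ w
        rn-fix = P.subst (λ m → pow w m ≈ w) card (fermat w)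

      Fixed-gcd⇒Fq : ∀ {w} → φ (gcd k r) w ≈ w → Fq w
      Fixed-gcd⇒Fq {w} gcd-fix with gcd[m,n]∣n k r
      ... | divides c r≡c*gcd = P.subst (λ j → φ j w ≈ w) (P.sym r≡c*gcd) (FixedBy.P-* w c gcd-fix)

      pow-q^-eigen : ∀ {z w} → Fq w → pow z q ≈ z * w → ∀ i → pow z (q N.^ i) ≈ z * pow w i
      pow-q^-eigen {z} {w} Fq-w zq≈zw zero    = trans (pow-identityʳ z) (sym (*-identityʳ z))
      pow-q^-eigen {z} {w} Fq-w zq≈zw (suc i) = begin
        pow z (q N.* q N.^ i)                ≈⟨ pow-pow z q (q N.^ i) ⟨
        pow (pow z q) (q N.^ i)              ≈⟨ pow-congˡ (q N.^ i) zq≈zw ⟩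
        pow (z * w) (q N.^ i)                ≈⟨ pow-distrib-* z w (q N.^ i) ⟩
        pow z (q N.^ i) * pow w (q N.^ i)    ≈⟨ *-cong (pow-q^-eigen Fq-w zq≈zw i) (Fq-pow-q^ Fq-w i) ⟩
        (z * pow w i) * w                    ≈⟨ *-assoc z (pow w i) w ⟩
        z * (pow w i * w)                    ≈⟨ *-congˡ (*-comm (pow w i) w) ⟩
        z * pow w (suc i)                    ∎

      -- w = z^(q-1) is fixed by the p^k-th and p^(rn)-th power maps, hence by the p^gcd(k,r)-th one,
      -- so w ∈ F_q; then z^(q^n) = z wⁿ gives wⁿ = 1, and gcd(n, p^gcd(k,r) - 1) = 1 forces w = 1.
      eigenvector⇒Fq : ∀ {z γ} → ¬ z ≈ 0# → Fq γ → ¬ γ ≈ 0# → φ k z ≈ γ * z → Fq z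
      eigenvector⇒Fq {z} {γ} z≉0 Fq-γ γ≉0 φkz≈γz = begin
        pow z q   ≈⟨ zq≈zw ⟩
        z * w     ≈⟨ *-congˡ w≈1 ⟩
        z * 1#    ≈⟨ *-identityʳ z ⟩
        z         ∎
        where
        w = pow z (N.pred q)
        zq≈zw : pow z q ≈ z * w
        zq≈zw = reflexive (P.cong (pow z) (P.sym (NP.suc-pred q)))
        k-fix : φ k w ≈ w
        k-fix = begin
          φ k w                       ≈⟨ pow-comm z (N.pred q) (p N.^ k) ⟩
          pow (φ k z) (N.pred q)      ≈⟨ pow-congˡ (N.pred q) φkz≈γz ⟩
          pow (γ * z) (N.pred q)      ≈⟨ pow-distrib-* γ z (N.pred q) ⟩
          pow γ (N.pred q) * w        ≈⟨ *-congʳ (pow≈self⇒pow-pred≈1 q γ≉0 Fq-γ) ⟩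
          1# * w                      ≈⟨ *-identityˡ w ⟩
          w                           ∎
        gcd-fix = Fixed-k⇒Fixed-gcd k-fix
        wⁿ≈1 : pow w n ≈ 1#
        wⁿ≈1 = *-cancelˡ z≉0 (trans (sym (pow-q^-eigen (Fixed-gcd⇒Fq gcd-fix) zq≈zw n))
                                   (trans (pow-q^n z) (sym (*-identityʳ z))))
        w^[p^d∸1]≈1 : pow w (p N.^ gcd k r N.∸ 1) ≈ 1#
        w^[p^d∸1]≈1 =
          pow≈self⇒pow-pred≈1 (p N.^ gcd k r) (λ w≈0 → z≉0 (pow≈0⇒≈0 (N.pred q) w≈0)) gcd-fix
        w≈1 : w ≈ 1#
        w≈1 = trans (sym (pow-identityʳ w))
                (PowersEqualToOne.bézout w (coprime-Bézout n⊥p^d∸1) wⁿ≈1 w^[p^d∸1]≈1)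

    module FqSubset = FiniteSubset (λ x → pow x q ≟ x) Fq-resp

    -- Complete permutation polynomials

    module CompletePermutation {k} (k⊥n : Coprime k n) (n⊥p^d∸1 : Coprime n (p N.^ gcd k r N.∸ 1))
             (p∤n : ¬ p ∣ n) (1<q : 1 N.< q) (n≥1 : n ≥ 1) {a} (Fq-a : Fq a) (a≉0 : ¬ a ≈ 0#) where
      open Eigenvector k⊥n n⊥p^d∸1

      e : ℕ
      e = p N.^ k N.∸ 1

      H : List Carrier → Carrier → Carrier
      H h t = eval h t + a * pow t e

      f : List Carrier → Carrier → Carrier
      f h x = x * (H h (Tr x) - a * pow x e)

      g : List Carrier → Carrier → Carrier
      g h y = y * eval h y

      x*xᵉ≈φkx : ∀ x → x * pow x e ≈ φ k x
      x*xᵉ≈φkx x = reflexive (P.cong (pow x) (NP.suc-pred (p N.^ k) ⦃ N.>-nonZero (NP.m^n>0 p k) ⦄))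

      Fq-H : ∀ h {t} → All Fq h → Fq t → Fq (H h t)
      Fq-H h Fq-h Fq-t = Fq-+ (Fq-eval h Fq-h Fq-t) (Fq-* Fq-a (Fq-pow Fq-t e))

      f≈linear : ∀ h x → f h x ≈ H h (Tr x) * x - a * φ k x
      f≈linear h x = begin
        x * (c - a * pow x e)        ≈⟨ x[y-z]≈xy-xz x c _ ⟩
        x * c - x * (a * pow x e)    ≈⟨ +-cong (*-comm x c) (-‿cong (*-x∙yz≈y∙xz x a _)) ⟩
        c * x - a * (x * pow x e)    ≈⟨ +-congˡ (-‿cong (*-congˡ (x*xᵉ≈φkx x))) ⟩
        c * x - a * φ k x            ∎
        where c = H h (Tr x)

      Tr∘f≈g∘Tr : ∀ h → All Fq h → ∀ x → Tr (f h x) ≈ g h (Tr x)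
      Tr∘f≈g∘Tr h Fq-h x = begin
        Tr (f h x)                             ≈⟨ Tr-cong (f≈linear h x) ⟩
        Tr (c * x - a * φ k x)                 ≈⟨ Tr.homo-sub _ _ ⟩
        Tr (c * x) - Tr (a * φ k x)            ≈⟨ +-cong (Tr-*ˡ (Fq-H h Fq-h (Fq-Tr x)) x) (-‿cong (Tr-*ˡ Fq-a _)) ⟩
        c * t - a * Tr (φ k x)                 ≈⟨ +-congˡ (-‿cong (*-congˡ (trans (Tr-φ k x) (sym (x*xᵉ≈φkx t))))) ⟩
        c * t - a * (t * u)                    ≈⟨ +-congʳ (trans (distribʳ t E (a * u)) (+-congˡ [au]t≈a[tu])) ⟩
        (E * t + a * (t * u)) - a * (t * u)    ≈⟨ +-congʳ (+-comm _ _) ⟩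
        (a * (t * u) + E * t) - a * (t * u)    ≈⟨ xyx⁻¹≈y _ _ ⟩
        E * t                                  ≈⟨ *-comm E t ⟩
        t * E                                  ∎
        where
        t = Tr x
        c = H h t
        E = eval h t
        u = pow t e
        [au]t≈a[tu] : (a * u) * t ≈ a * (t * u)
        [au]t≈a[tu] = trans (*-assoc a u t) (*-congˡ (*-comm u t))

      trace-zero-eigenvector≈0 : ∀ {z γ} → Tr z ≈ 0# → Fq γ → φ k z ≈ γ * z → z ≈ 0#
      trace-zero-eigenvector≈0 {z} {γ} Trz≈0 Fq-γ φkz≈γz with z ≟ 0#
      ... | yes z≈0 = z≈0
      ... | no  z≉0 = ⊥-elim (n·1#≉0# p∤n (*-cancelʳ z≉0 (trans [n·1#]z≈0 (sym (zeroˡ z)))))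
        where
        γ≉0 : ¬ γ ≈ 0#
        γ≉0 γ≈0 = z≉0 (pow≈0⇒≈0 (p N.^ k) (trans φkz≈γz (trans (*-congʳ γ≈0) (zeroˡ z))))
        [n·1#]z≈0 : (n · 1#) * z ≈ 0#
        [n·1#]z≈0 =
          trans (sym (·-as-* n z)) (trans (sym (Tr-Fq (eigenvector⇒Fq z≉0 Fq-γ γ≉0 φkz≈γz))) Trz≈0)

      f-injective : ∀ h → All Fq h → IsPermOn Fq (g h) → ∀ {x y} → f h x ≈ f h y → x ≈ y
      f-injective h Fq-h (_ , g-injective , _) {x} {y} fx≈fy =
        x-y≈0⇒x≈y (trace-zero-eigenvector≈0 Trz≈0 (Fq-* Fq-a⁻¹ Fq-c) φkz≈γz)
        where
        z = x - y
        Trx≈Try : Tr x ≈ Tr y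
        Trx≈Try = g-injective (Tr x) (Tr y) (Fq-Tr x) (Fq-Tr y)
                    (trans (sym (Tr∘f≈g∘Tr h Fq-h x)) (trans (Tr-cong fx≈fy) (Tr∘f≈g∘Tr h Fq-h y)))
        Trz≈0 : Tr z ≈ 0#
        Trz≈0 = trans (Tr.homo-sub x y) (x≈y⇒x-y≈0 Trx≈Try)
        c = H h (Tr x)
        Fq-c = Fq-H h Fq-h (Fq-Tr x)
        cz≈aφkz : c * z ≈ a * φ k z
        cz≈aφkz = begin
          c * z                      ≈⟨ x[y-z]≈xy-xz c x y ⟩
          c * x - c * y              ≈⟨ x-u≈y-v⇒x-y≈u-v (begin
            c * x - a * φ k x           ≈⟨ f≈linear h x ⟨
            f h x                       ≈⟨ fx≈fy ⟩
            f h y                       ≈⟨ f≈linear h y ⟩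
            H h (Tr y) * y - a * φ k y  ≈⟨ +-congʳ (*-congʳ (+-cong (eval-cong h (sym Trx≈Try))
                                             (*-congˡ (pow-congˡ e (sym Trx≈Try))))) ⟩
            c * y - a * φ k y           ∎) ⟩
          a * φ k x - a * φ k y      ≈⟨ x[y-z]≈xy-xz a _ _ ⟨
          a * (φ k x - φ k y)        ≈⟨ *-congˡ (φ.homo-sub k x y) ⟨
          a * φ k z                  ∎
        a⁻¹ = proj₁ (inverse a a≉0)
        a⁻¹a≈1 : a⁻¹ * a ≈ 1#
        a⁻¹a≈1 = trans (*-comm a⁻¹ a) (proj₂ (inverse a a≉0))
        Fq-a⁻¹ : Fq a⁻¹
        Fq-a⁻¹ = Fq-inverse Fq-a (proj₂ (inverse a a≉0))
        φkz≈γz : φ k z ≈ (a⁻¹ * c) * z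
        φkz≈γz = begin
          φ k z                ≈⟨ *-identityˡ _ ⟨
          1# * φ k z           ≈⟨ *-congʳ a⁻¹a≈1 ⟨
          (a⁻¹ * a) * φ k z    ≈⟨ *-assoc a⁻¹ a _ ⟩
          a⁻¹ * (a * φ k z)    ≈⟨ *-congˡ cz≈aφkz ⟨
          a⁻¹ * (c * z)        ≈⟨ *-assoc a⁻¹ c z ⟨
          (a⁻¹ * c) * z        ∎

      f-IsPermOn : ∀ h → All Fq h → IsPermOn Fq (g h) → IsPermOn Everything (f h)
      f-IsPermOn h Fq-h g-perm =
          (λ _ _ → tt)
        , (λ _ _ _ _ → f-injective h Fq-h g-perm)
        , (λ y _ → let (x , fx≈y) = injective⇒surjective (f-injective h Fq-h g-perm) y in x , tt , fx≈y)

      g-IsPermOn : ∀ h → All Fq h → IsPermOn Everything (f h) → IsPermOn Fq (g h)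
      g-IsPermOn h Fq-h (_ , _ , f-surjective) =
        FqSubset.surjective⇒IsPermOn (λ x≈y → *-cong x≈y (eval-cong h x≈y))
          (λ y Fq-y → Fq-* Fq-y (Fq-eval h Fq-h Fq-y)) g-surjective
        where
        g-surjective : ∀ y → Fq y → Σ Carrier λ t → Fq t × g h t ≈ y
        g-surjective y Fq-y with Tr-surjective 1<q n≥1 y Fq-y
        ... | x₀ , Trx₀≈y with f-surjective x₀ tt
        ...   | x , _ , fx≈x₀ =
          Tr x , Fq-Tr x , trans (sym (Tr∘f≈g∘Tr h Fq-h x)) (trans (Tr-cong fx≈x₀) Trx₀≈y)

      f+id≈f[h+1] : ∀ h x → f h x + x ≈ f (h ⊕ (1# ∷ [])) x
      f+id≈f[h+1] h x = begin
        x * ((E + A) - B) + x              ≈⟨ +-congˡ (*-identityʳ x) ⟨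
        x * ((E + A) - B) + x * 1#         ≈⟨ distribˡ x _ 1# ⟨
        x * (((E + A) - B) + 1#)           ≈⟨ *-congˡ (+-xy∙z≈xz∙y (E + A) (- B) 1#) ⟩
        x * (((E + A) + 1#) - B)           ≈⟨ *-congˡ (+-congʳ (+-xy∙z≈xz∙y E A 1#)) ⟩
        x * (((E + 1#) + A) - B)           ≈⟨ *-congˡ (+-congʳ (+-congʳ (eval-+1 h (Tr x)))) ⟨
        x * ((eval (h ⊕ (1# ∷ [])) (Tr x) + A) - B) ∎
        where
        E = eval h (Tr x)
        A = a * pow (Tr x) e
        B = a * pow x e

      g+id≈g[h+1] : ∀ h y → g h y + y ≈ g (h ⊕ (1# ∷ [])) y
      g+id≈g[h+1] h y = begin
        y * eval h y + y                  ≈⟨ +-congˡ (*-identityʳ y) ⟨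
        y * eval h y + y * 1#             ≈⟨ distribˡ y _ 1# ⟨
        y * (eval h y + 1#)               ≈⟨ *-congˡ (eval-+1 h y) ⟨
        y * eval (h ⊕ (1# ∷ [])) y        ∎

      complete⇔ : ∀ h → All Fq h → IsCompletePermOn Everything (f h) ⇔ IsCompletePermOn Fq (g h)
      complete⇔ h Fq-h = mk⇔
        (λ (f-perm , f+id-perm) → g-IsPermOn h Fq-h f-perm
          , IsPermOn-cong Fq-resp (λ y → sym (g+id≈g[h+1] h y))
              (g-IsPermOn h⁺ Fq-h⁺ (IsPermOn-cong (λ _ _ → tt) (f+id≈f[h+1] h) f+id-perm)))
        (λ (g-perm , g+id-perm) → f-IsPermOn h Fq-h g-perm
          , IsPermOn-cong (λ _ _ → tt) (λ x → sym (f+id≈f[h+1] h x))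
              (f-IsPermOn h⁺ Fq-h⁺ (IsPermOn-cong Fq-resp (g+id≈g[h+1] h) g+id-perm)))
        where
        h⁺ = h ⊕ (1# ∷ [])
        Fq-h⁺ : All Fq h⁺
        Fq-h⁺ = Fq-⊕ Fq-h (Fq-1# ∷ [])

theorem4 : (p r n k : ℕ) → Prime p → r ≥ 1 → n ≥ 1 →
    (F : FiniteField) → length (FiniteField.elements F) ≡ p N.^ (r N.* n) →
    (h : List (FiniteField.Carrier F)) →
    All (FieldOps.InSub F (p N.^ r)) h →
    k ≥ 1 → gcd k n ≡ 1 → ¬ (p ∣ n) → gcd n (p N.^ gcd k r N.∸ 1) ≡ 1 →
    (a : FiniteField.Carrier F) → FieldOps.InSub F (p N.^ r) a →
    ¬ (FiniteField._≈_ F a (FiniteField.0# F)) →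
    let open FiniteField F
        open FieldOps F
        q = p N.^ r
        e = p N.^ k N.∸ 1
    in IsCompletePermOn Everything
         (λ x → x * ((eval h (trace q n x) + a * pow (trace q n x) e) - a * pow x e))
       ⇔ IsCompletePermOn (InSub q) (λ x → x * eval h x)
theorem4 p r n k p-prime r≥1 n≥1 F card h Fq-h _ gcd[k,n]≡1 p∤n gcd[n,p^d∸1]≡1 a Fq-a a≉0 =
  complete⇔ h Fq-h
  where
  open FiniteFieldTheory F
  open Subfield p-prime r n card
  1<q : 1 N.< q
  1<q = NP.^-monoʳ-< p (N.nonTrivial⇒n>1 p ⦃ prime⇒nonTrivial p-prime ⦄) r≥1
  open CompletePermutation {k} (gcd≡1⇒coprime gcd[k,n]≡1) (gcd≡1⇒coprime gcd[n,p^d∸1]≡1)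
                           p∤n 1<q n≥1 Fq-a a≉0
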